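{- Let $D^{(1)},\ldots,D^{(e)}$ be $e$ points in $\mathbb{R}^e/\mathbb{R}\mathbf{1}$ and let $A$ be the $e\times e$ matrix with $A_{ij}=D^{(i)}_j$. Then the minimum, over all tropical hyperplanes $\mathcal H$ in $\mathbb{R}^e/\mathbb{R}\mathbf{1}$, of the total distance $\sum_{j=1}^e d_{\rm tr}(D^{(j)},\mathcal H)$ equals the tropical volume $\operatorname{tvol}(A)$. Moreover, this minimum is attained by a tropical hyperplane which is the Stiefel tropical linear space of the $(e-1)\times e$ matrix formed by some choice of $e-1$ of the rows of $A$ (i.e. spanned by $e-1$ of the points).
   Context: Tropical arithmetic is max-plus. The tropical distance on $\mathbb{R}^e/\mathbb{R}\mathbf{1}$ is $d_{\rm tr}(v,w)=\max_{1\le i<j\le e}|v_i-w_i-v_j+w_j|$, and for a set $S$, $d_{\rm tr}(u,S)=\inf_{x\in S}d_{\rm tr}(u,x)$. The tropical determinant of a square $k\times k$ matrix $M$ is $\operatorname{tdet}M=\max_{\sigma\in S_k}\sum_i M_{i,\sigma(i)}$. The tropical volume of an $e\times e$ real matrix $A$ is $\operatorname{tvol}A=\max_{\sigma\in S_e}\sum_i a_{i,\sigma(i)}-\max_{\tau\in S_e\setminus\{\sigma_{opt}\}}\sum_i a_{i,\tau(i)}$, where $\sigma_{opt}$ is a permutation attaining the first maximum (so $\operatorname{tvol}A=0$ if the maximum is attained twice). A tropical hyperplane is, for some real vector $v=(v_1,\dots,v_e)$, the set of $x\in\mathbb{R}^e/\mathbb{R}\mathbf{1}$ such that $\max_i(-v_i+x_i)$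 is attained at least twice. For a $d\times e$ real matrix $M$ and a $d$-subset $\omega\subseteq[e]$, let $M_\omega$ be the $d\times d$ submatrix of columns indexed by $\omega$; the map $p(\omega)=\operatorname{tdet}(M_\omega)$ is a tropical Plücker vector, and the Stiefel tropical linear space of $M$ is $L_p=\{x\in\mathbb{R}^e/\mathbb{R}\mathbf{1}:$ for every $(d+1)$-subset $\tau\subseteq[e]$, $\max_{i\in\tau}(p(\tau\setminus\{i\})+x_i)$ is attained at least twice$\}$. For $d=e-1$ this is a tropical hyperplane. -}

module Defs where

open import Level using (0ℓ)
open import Data.Nat using (ℕ; zero; suc)
open import Data.Fin using (Fin; punchIn) renaming (zero to fzero; suc to fsuc) renaming (_<_ to _<ᶠ_; _<?_ to _<ᶠ?_)
open import Data.Fin.Permutation using (Permutation′; _⟨$⟩ʳ_)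
open import Data.List using (List; foldr; map; allFin)
open import Data.Product using (Σ; ∃; ∃₂; _×_; _,_; proj₁)
open import Relation.Binary.PropositionalEquality using (_≡_; _≢_)
open import Relation.Binary.Structures using (IsDecTotalOrder)
open import Relation.Nullary using (yes; no)
open import Algebra.Structures using (IsCommutativeRing)

-- An abstract model of the real numbers: a Dedekind-complete ordered field
-- (axiomatised; the standard library has no real numbers).
record RealField : Set₁ where
  infixl 6 _+_
  infixl 7 _*_
  infix 4 _≤_
  infix 8 -_
  field
    Carrier : Set
    _+_ _*_ : Carrier → Carrier → Carrier
    -_ : Carrier → Carrier
    0# 1# : Carrier
    _≤_ : Carrier → Carrier → Set
    isCommutativeRing : IsCommutativeRing _≡_ _+_ _*_ -_ 0# 1#
    0≢1 : 0# ≢ 1#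
    inverse : ∀ x → x ≢ 0# → ∃ λ y → x * y ≡ 1#
    isDecTotalOrder : IsDecTotalOrder _≡_ _≤_
    +-mono-≤ : ∀ {x y} z → x ≤ y → x + z ≤ y + z
    *-nonneg : ∀ {x y} → 0# ≤ x → 0# ≤ y → 0# ≤ x * y
    complete : (S : Carrier → Set) → (∃ S) → (∃ λ b → ∀ x → S x → x ≤ b) →
               ∃ λ s → (∀ x → S x → x ≤ s) × (∀ b → (∀ x → S x → x ≤ b) → s ≤ b)

module Tropical (ℝ : RealField) where
  open RealField ℝ public
  open IsDecTotalOrder isDecTotalOrder using (_≤?_)

  infixl 6 _-_
  _-_ : Carrier → Carrier → Carrier
  x - y = x + (- y)

  max : Carrier → Carrier → Carrier
  max x y with x ≤? y
  ... | yes _ = y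
  ... | no _ = x

  ∣_∣ : Carrier → Carrier
  ∣ x ∣ = max x (- x)

  -- points of R^e (representatives of points of R^e / R1; all notions below
  -- are invariant under adding multiples of the all-ones vector)
  Point : ℕ → Set
  Point e = Fin e → Carrier

  ∑ : ∀ {n} → (Fin n → Carrier) → Carrier
  ∑ {zero} f = 0#
  ∑ {suc n} f = f fzero + ∑ (λ i → f (fsuc i))

  -- max of a list, with value 0 for the empty list
  max₀ : List Carrier → Carrier
  max₀ = foldr max 0#

  -- tropical distance: max over i < j of |v_i - w_i - v_j + w_j|
  -- (0 when there are no pairs; all terms are ≥ 0)
  dtr : ∀ {e} → Point e → Point e → Carrier
  dtr {e} v w = max₀ (map (λ i → max₀ (map (λ j → term i j) (allFin e))) (allFin e))
    where
    term : Fin e → Fin e → Carrier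
    term i j with i <ᶠ? j
    ... | yes _ = ∣ v i - w i - v j + w j ∣
    ... | no _ = 0#

  DistToSet : ∀ {e} → Point e → (Point e → Set) → Carrier → Set
  DistToSet u S d =
    (∀ x → S x → d ≤ dtr u x) × (∀ b → (∀ x → S x → b ≤ dtr u x) → b ≤ d)

  IsMax : (I : Set) → (I → Carrier) → Carrier → Set
  IsMax I f m = (∃ λ i → f i ≡ m) × (∀ i → f i ≤ m)

  AttainedTwice : ∀ {n} → (Fin n → Carrier) → Set
  AttainedTwice f = ∃₂ λ i j → i ≢ j × f i ≡ f j × (∀ k → f k ≤ f i)

  permSum : ∀ {k} → (Fin k → Fin k → Carrier) → Permutation′ k → Carrier
  permSum M σ = ∑ (λ i → M i (σ ⟨$⟩ʳ i))

  IsTdet : ∀ {k} → (Fin k → Fin k → Carrier) → Carrier → Set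
  IsTdet {k} M t = IsMax (Permutation′ k) (permSum M) t

  -- tvol A = t : the optimal permutation weight minus the maximum weight
  -- over all other permutations
  IsTvol : ∀ {e} → (Fin e → Fin e → Carrier) → Carrier → Set
  IsTvol {e} A t = ∃ λ σ → (∀ τ → permSum A τ ≤ permSum A σ) ×
    ∃ λ m → IsMax (Σ (Permutation′ e) (λ τ → ∃ λ i → τ ⟨$⟩ʳ i ≢ σ ⟨$⟩ʳ i))
                  (λ { (τ , _) → permSum A τ }) m
            × t ≡ permSum A σ - m

  Hyperplane : ∀ {e} → Point e → Point e → Set
  Hyperplane v x = AttainedTwice (λ i → - v i + x i)

  -- d-subsets of [e], as strictly increasing maps Fin d → Fin e
  Subset : ℕ → ℕ → Set
  Subset d e = Σ (Fin d → Fin e) λ ω → ∀ a b → a <ᶠ b → ω a <ᶠ ω b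

  -- Stiefel tropical linear space of the d × e matrix M, with p(ω) = tdet M_ω
  Stiefel : ∀ {d e} → (Fin d → Fin e → Carrier) → Point e → Set
  Stiefel {d} {e} M x =
    (τ : Subset (suc d) e) →
    (p : Fin (suc d) → Carrier) →
    (∀ k → IsTdet (λ r c → M r (proj₁ τ (punchIn k c))) (p k)) →
    AttainedTwice (λ k → p k + x (proj₁ τ k))

module Submission where

-- Lower bound. If x lies on the hyperplane with apex v, then dtr(A j, x) is at
-- least the gap between (A j - v) at σ j and its best other coordinate g j
-- (gap≤dtr). Following g along the cycles of σ⁻¹ ∘ g changes σ into a
-- permutation τ ≠ σ losing at most these gaps (exchange), so t ≤ S σ - S τ ≤ ∑ gaps.
--
-- Upper bound. Choose a second-best τ₂ and a row i with τ₂ i ≠ σ i, and take as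
-- apex minus the tropical minors of A along row i. Every other row lies on this
-- hyperplane, since replacing row i by it gives a singular matrix
-- (repeated-row-singular); row i is at distance exactly t (near-point). This
-- hyperplane is the Stiefel tropical linear space of the other rows, because the
-- only e-subset of [e] is [e] itself (increasing⇒id).

open import Defs
open import Level using (0ℓ)
open import Data.Nat as ℕ using (ℕ; zero; suc; s≤s; z≤n) renaming (_≤_ to _≤ℕ_)
import Data.Nat.Properties as ℕₚ
open import Data.Nat.GeneralisedArithmetic using (fold; fold-+)
open import Data.Fin as Fin using (Fin; toℕ; fromℕ<; inject₁; opposite; punchIn; punchOut)
  renaming (zero to fzero; suc to fsuc; _<_ to _<ᶠ_; _<?_ to _<ᶠ?_)
import Data.Fin.Properties as Finₚ
open import Data.Fin.Permutation
  using (id; Permutation′; permutation; _⟨$⟩ʳ_; _⟨$⟩ˡ_; remove; insert; insert-punchIn; punchIn-permute; inverseˡ; inverseʳ; _∘ₚ_; transpose)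
import Data.Fin.Permutation.Components as PermComponents
open import Data.List using ([]; _∷_; map; allFin)
open import Data.List.Membership.Propositional using (_∈_)
open import Data.List.Membership.Propositional.Properties using (∈-map⁺; ∈-allFin)
open import Data.List.Relation.Unary.Any using (here; there)
open import Data.List.Relation.Unary.All using (All; []; _∷_)
import Data.List.Relation.Unary.All.Properties as Allₚ
open import Data.Product using (∃; _×_; _,_; proj₁; proj₂)
open import Data.Sum using (_⊎_; inj₁; inj₂)
open import Data.Empty using (⊥-elim)
open import Function.Base using (_∘_)
open import Relation.Nullary using (Dec; yes; no; ¬_)
open import Relation.Binary.Definitions using (tri<; tri≈; tri>)
open import Relation.Binary.PropositionalEquality
  using (_≡_; _≢_; refl; sym; trans; cong; cong₂; subst; subst₂; module ≡-Reasoning)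
open import Relation.Binary.Bundles using (DecTotalOrder)
open import Algebra.Bundles using (CommutativeRing)

StrictlyIncreasing : ∀ {m n} → (Fin m → Fin n) → Set
StrictlyIncreasing f = ∀ a b → a Fin.< b → f a Fin.< f b

increasing⇒≥ : ∀ {m n} (f : Fin m → Fin n) → StrictlyIncreasing f → ∀ k → toℕ k ℕ.≤ toℕ (f k)
increasing⇒≥ f inc fzero = z≤n
increasing⇒≥ f inc (fsuc k) = begin
  suc (toℕ k)               ≤⟨ s≤s (increasing⇒≥ (λ a → f (inject₁ a)) inc′ k) ⟩
  suc (toℕ (f (inject₁ k))) ≤⟨ inc (inject₁ k) (fsuc k) (s≤s (ℕₚ.≤-reflexive (Finₚ.toℕ-inject₁ k))) ⟩
  toℕ (f (fsuc k))          ∎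
  where
  open ℕₚ.≤-Reasoning
  inc′ : StrictlyIncreasing (λ a → f (inject₁ a))
  inc′ a b a<b = inc _ _ (subst₂ ℕ._<_ (sym (Finₚ.toℕ-inject₁ a)) (sym (Finₚ.toℕ-inject₁ b)) a<b)

opposite-< : ∀ {n} {a b : Fin n} → a Fin.< b → opposite b Fin.< opposite a
opposite-< {n} {a} {b} a<b =
  subst₂ ℕ._<_ (sym (Finₚ.opposite-prop b)) (sym (Finₚ.opposite-prop a))
         (ℕₚ.∸-monoʳ-< (s≤s a<b) (Finₚ.toℕ<n b))

-- The only strictly increasing self-map of Fin n is the identity: it moves
-- no point down, and neither does its conjugate by reversal.
increasing⇒id : ∀ {n} (f : Fin n → Fin n) → StrictlyIncreasing f → ∀ k → f k ≡ k
increasing⇒id {n} f inc k = Finₚ.toℕ-injective (ℕₚ.≤-antisym f≤ (increasing⇒≥ f inc k))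
  where
  f̃ : Fin n → Fin n
  f̃ a = opposite (f (opposite a))
  f̃-inc : StrictlyIncreasing f̃
  f̃-inc a b a<b = opposite-< (inc _ _ (opposite-< a<b))
  reversed : toℕ (opposite k) ℕ.≤ toℕ (opposite (f k))
  reversed = subst (λ z → toℕ (opposite k) ℕ.≤ toℕ (opposite (f z)))
                   (Finₚ.opposite-involutive k) (increasing⇒≥ f̃ f̃-inc (opposite k))
  f≤ : toℕ (f k) ℕ.≤ toℕ k
  f≤ = ℕₚ.≤-pred (ℕₚ.∸-cancelʳ-≤ (Finₚ.toℕ<n (f k))
         (subst₂ ℕ._≤_ (Finₚ.opposite-prop k) (Finₚ.opposite-prop (f k)) reversed))

-- The periodic points of a self-map h of Fin n, and the permutation that
-- moves each of them one step along its cycle while fixing every other point.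
module PeriodicPoints {n : ℕ} (h : Fin n → Fin n) where

  iter : ℕ → Fin n → Fin n
  iter k y = fold y h k

  iter-comm : ∀ a b y → iter a (iter b y) ≡ iter b (iter a y)
  iter-comm a b y = begin
    fold (fold y h b) h a ≡⟨ sym (fold-+ y h a) ⟩
    fold y h (a ℕ.+ b)    ≡⟨ cong (fold y h) (ℕₚ.+-comm a b) ⟩
    fold y h (b ℕ.+ a)    ≡⟨ fold-+ y h b ⟩
    fold (fold y h a) h b ∎
    where open ≡-Reasoning

  Periodic : Fin n → Set
  Periodic y = ∃ λ (k : Fin n) → iter (suc (toℕ k)) y ≡ y

  periodic? : ∀ y → Dec (Periodic y)
  periodic? y = Finₚ.any? (λ k → iter (suc (toℕ k)) y Fin.≟ y)

  periodic-iter : ∀ m {y} → Periodic y → Periodic (iter m y)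
  periodic-iter m {y} (k , returns) = k , trans (iter-comm (suc (toℕ k)) m y) (cong (iter m) returns)

  -- every orbit reaches a periodic point, by the pigeonhole principle on y, h y, …, hⁿ y
  periodic-exists : Fin n → ∃ Periodic
  periodic-exists y with Finₚ.pigeonhole (ℕₚ.n<1+n n) (λ (a : Fin (suc n)) → iter (toℕ a) y)
  ... | a , b , a<b , same = iter (toℕ a) y , fromℕ< ℓ<n , returns
    where
    ℓ : ℕ
    ℓ = toℕ b ℕ.∸ suc (toℕ a)
    split : suc (toℕ a) ℕ.+ ℓ ≡ toℕ b
    split = ℕₚ.m+[n∸m]≡n a<b
    ℓ<n : ℓ ℕ.< n
    ℓ<n = ℕₚ.<-≤-trans (ℕₚ.m<n+m ℓ (s≤s z≤n)) (subst (ℕ._≤ n) (sym split) (ℕₚ.≤-pred (Finₚ.toℕ<n b)))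
    returns : iter (suc (toℕ (fromℕ< ℓ<n))) (iter (toℕ a) y) ≡ iter (toℕ a) y
    returns = begin
      iter (suc (toℕ (fromℕ< ℓ<n))) (iter (toℕ a) y) ≡⟨ cong (λ z → iter (suc z) (iter (toℕ a) y)) (Finₚ.toℕ-fromℕ< ℓ<n) ⟩
      iter (suc ℓ) (iter (toℕ a) y)                  ≡⟨ sym (fold-+ y h (suc ℓ)) ⟩
      iter (suc ℓ ℕ.+ toℕ a) y                       ≡⟨ cong (λ z → iter z y) (trans (ℕₚ.+-comm (suc ℓ) (toℕ a)) (trans (ℕₚ.+-suc (toℕ a) ℓ) split)) ⟩
      iter (toℕ b) y                                 ≡⟨ sym same ⟩
      iter (toℕ a) y                                 ∎
      where open ≡-Reasoning

  step : Fin n → Fin n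
  step y with periodic? y
  ... | yes _ = h y
  ... | no _ = y

  -- a periodic point returning after 1 + k steps has hᵏ y as its predecessor
  back : Fin n → Fin n
  back y with periodic? y
  ... | yes (k , _) = iter (toℕ k) y
  ... | no _ = y

  step-back-cases : ∀ y → (∃ λ k → iter (suc (toℕ k)) y ≡ y × step y ≡ h y × back y ≡ iter (toℕ k) y)
                          ⊎ (¬ Periodic y × step y ≡ y × back y ≡ y)
  step-back-cases y with periodic? y
  ... | yes (k , returns) = inj₁ (k , returns , refl , refl)
  ... | no aperiodic = inj₂ (aperiodic , refl , refl)

  step-periodic : ∀ {y} → Periodic y → step y ≡ h y
  step-periodic {y} py with step-back-cases y
  ... | inj₁ (_ , _ , moves , _) = moves
  ... | inj₂ (aperiodic , _) = ⊥-elim (aperiodic py)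

  step-back : ∀ y → step (back y) ≡ y
  step-back y with step-back-cases y
  ... | inj₁ (k , returns , _ , backs) =
        trans (cong step backs) (trans (step-periodic (periodic-iter (toℕ k) (k , returns))) returns)
  ... | inj₂ (_ , stays , backs) = trans (cong step backs) stays

  back-step : ∀ y → back (step y) ≡ y
  back-step y with step-back-cases y
  ... | inj₂ (_ , stays , backs) = trans (cong back stays) backs
  ... | inj₁ (k , returns , moves , _) with step-back-cases (h y)
  ...   | inj₂ (aperiodic , _) = ⊥-elim (aperiodic (periodic-iter 1 (k , returns)))
  ...   | inj₁ (k′ , returns′ , _ , backs′) = trans (cong back moves) (trans backs′ (begin
          a                      ≡⟨ sym (proj₂ (periodic-iter (toℕ k′) (periodic-iter 1 (k , returns)))) ⟩
          h (iter (toℕ k) a)     ≡⟨ iter-comm 1 (toℕ k) a ⟩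
          iter (toℕ k) (h a)     ≡⟨ cong (iter (toℕ k)) returns′ ⟩
          iter (toℕ k) (h y)     ≡⟨ iter-comm (toℕ k) 1 y ⟩
          iter (suc (toℕ k)) y   ≡⟨ returns ⟩
          y                      ∎))
    where
    open ≡-Reasoning
    a = iter (toℕ k′) (h y)

  cycle : Permutation′ n
  cycle = permutation step back step-back back-step

cycle-permutation : ∀ {n} (h : Fin n → Fin n) → Fin n →
  ∃ λ (ρ : Permutation′ n) → (∀ y → ρ ⟨$⟩ʳ y ≡ y ⊎ ρ ⟨$⟩ʳ y ≡ h y) × (∃ λ y → ρ ⟨$⟩ʳ y ≡ h y)
cycle-permutation h y₀ with PeriodicPoints.periodic-exists h y₀
... | y , y-periodic = cycle , follows-or-fixes , y , step-periodic y-periodic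
  where
  open PeriodicPoints h
  follows-or-fixes : ∀ x → step x ≡ x ⊎ step x ≡ h x
  follows-or-fixes x with step-back-cases x
  ... | inj₁ (_ , _ , moves , _) = inj₂ moves
  ... | inj₂ (_ , stays , _) = inj₁ stays

module Geometry (ℝ : RealField) where
  open Tropical ℝ

  commutativeRing : CommutativeRing 0ℓ 0ℓ
  commutativeRing = record { isCommutativeRing = isCommutativeRing }

  order : DecTotalOrder 0ℓ 0ℓ 0ℓ
  order = record { isDecTotalOrder = isDecTotalOrder }

  open CommutativeRing commutativeRing using (+-assoc; +-comm; +-identityˡ; +-identityʳ; -‿inverseʳ; +-abelianGroup)
  open import Algebra.Properties.AbelianGroup +-abelianGroup
    using (⁻¹-involutive; ⁻¹-anti-homo‿-; ⁻¹-∙-comm; ε⁻¹≈ε)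
  open import Algebra.Properties.CommutativeSemigroup (CommutativeRing.+-commutativeSemigroup commutativeRing)
    using (interchange; x∙yz≈y∙xz)
  open DecTotalOrder order using (_≤?_) renaming (refl to ≤-refl; trans to ≤-trans; antisym to ≤-antisym; reflexive to ≤-reflexive)
  open import Relation.Binary.Properties.TotalOrder (DecTotalOrder.totalOrder order) using (≰⇒≥)
  open import Relation.Binary.Reasoning.PartialOrder (DecTotalOrder.poset order)

  x-x≡0 : ∀ x → x - x ≡ 0#
  x-x≡0 = -‿inverseʳ

  x-0≡x : ∀ x → x - 0# ≡ x
  x-0≡x x = trans (cong (x +_) ε⁻¹≈ε) (+-identityʳ x)

  neg-sub : ∀ x y → - (x - y) ≡ y - x
  neg-sub = ⁻¹-anti-homo‿-

  x+[-x+y]≡y : ∀ x y → x + (- x + y) ≡ y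
  x+[-x+y]≡y x y = begin-equality
    x + (- x + y) ≡⟨ sym (+-assoc x (- x) y) ⟩
    (x - x) + y   ≡⟨ cong (_+ y) (x-x≡0 x) ⟩
    0# + y        ≡⟨ +-identityˡ y ⟩
    y             ∎

  x-[x-y]≡y : ∀ x y → x - (x - y) ≡ y
  x-[x-y]≡y x y = begin-equality
    x - (x - y)   ≡⟨ cong (x +_) (neg-sub x y) ⟩
    x + (y - x)   ≡⟨ +-comm x (y - x) ⟩
    (y - x) + x   ≡⟨ +-assoc y (- x) x ⟩
    y + (- x + x) ≡⟨ cong (y +_) (trans (+-comm (- x) x) (x-x≡0 x)) ⟩
    y + 0#        ≡⟨ +-identityʳ y ⟩
    y             ∎

  sub-interchange : ∀ a b c d → (a - b) - (c - d) ≡ (a - c) - (b - d)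
  sub-interchange a b c d = begin-equality
    (a - b) - (c - d)     ≡⟨ cong ((a - b) +_) (trans (neg-sub c d) (+-comm d (- c))) ⟩
    (a - b) + (- c + d)   ≡⟨ interchange a (- b) (- c) d ⟩
    (a - c) + (- b + d)   ≡⟨ cong ((a - c) +_) (trans (+-comm (- b) d) (sym (neg-sub b d))) ⟩
    (a - c) - (b - d)     ∎

  shift-cancel : ∀ a b c → (a - c) - (b - c) ≡ a - b
  shift-cancel a b c = trans (sub-interchange a c b c) (trans (cong (λ z → (a - b) - z) (x-x≡0 c)) (x-0≡x (a - b)))

  +-monoʳ : ∀ {x y} z → x ≤ y → z + x ≤ z + y
  +-monoʳ {x} {y} z x≤y = subst₂ _≤_ (+-comm x z) (+-comm y z) (+-mono-≤ z x≤y)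

  +-mono : ∀ {a b c d} → a ≤ b → c ≤ d → a + c ≤ b + d
  +-mono {a} {b} {c} a≤b c≤d = ≤-trans (+-mono-≤ c a≤b) (+-monoʳ b c≤d)

  neg-antitone : ∀ {x y} → x ≤ y → - y ≤ - x
  neg-antitone {x} {y} x≤y = begin
    - y                   ≡⟨ sym (x+[-x+y]≡y x (- y)) ⟩
    x + (- x + - y)       ≤⟨ +-mono-≤ (- x + - y) x≤y ⟩
    y + (- x + - y)       ≡⟨ cong (y +_) (+-comm (- x) (- y)) ⟩
    y + (- y + - x)       ≡⟨ x+[-x+y]≡y y (- x) ⟩
    - x                   ∎

  sub-antitone : ∀ {x y} z → x ≤ y → z - y ≤ z - x
  sub-antitone z x≤y = +-monoʳ z (neg-antitone x≤y)

  x≤x+d : ∀ {x d} → 0# ≤ d → x ≤ x + d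
  x≤x+d {x} 0≤d = subst (_≤ x + _) (+-identityʳ x) (+-monoʳ x 0≤d)

  0≤y-x : ∀ {x y} → x ≤ y → 0# ≤ y - x
  0≤y-x {x} x≤y = subst (_≤ _) (x-x≡0 x) (+-mono-≤ (- x) x≤y)

  max-≥ˡ : ∀ x y → x ≤ max x y
  max-≥ˡ x y with x ≤? y
  ... | yes x≤y = x≤y
  ... | no _ = ≤-refl

  max-≥ʳ : ∀ x y → y ≤ max x y
  max-≥ʳ x y with x ≤? y
  ... | yes _ = ≤-refl
  ... | no x≰y = ≰⇒≥ x≰y

  max-lub : ∀ {x y b} → x ≤ b → y ≤ b → max x y ≤ b
  max-lub {x} {y} x≤b y≤b with x ≤? y
  ... | yes _ = y≤b
  ... | no _ = x≤b

  ∣difference∣≤ : ∀ {α β g} → 0# ≤ α → α ≤ g → 0# ≤ β → β ≤ g → ∣ α - β ∣ ≤ g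
  ∣difference∣≤ {α} {β} {g} 0≤α α≤g 0≤β β≤g = max-lub (bound α β 0≤β α≤g)
    (subst (_≤ g) (sym (neg-sub α β)) (bound β α 0≤α β≤g))
    where
    bound : ∀ a b → 0# ≤ b → a ≤ g → a - b ≤ g
    bound a b 0≤b a≤g = begin
      a - b  ≤⟨ sub-antitone a 0≤b ⟩
      a - 0# ≡⟨ x-0≡x a ⟩
      a      ≤⟨ a≤g ⟩
      g      ∎

  max₀-upper : ∀ {x xs} → x ∈ xs → x ≤ max₀ xs
  max₀-upper {xs = y ∷ ys} (here refl) = max-≥ˡ y (max₀ ys)
  max₀-upper {xs = y ∷ ys} (there x∈ys) = ≤-trans (max₀-upper x∈ys) (max-≥ʳ y (max₀ ys))

  max₀-least : ∀ {b xs} → 0# ≤ b → All (_≤ b) xs → max₀ xs ≤ b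
  max₀-least 0≤b [] = 0≤b
  max₀-least 0≤b (x≤b ∷ xs≤b) = max-lub x≤b (max₀-least 0≤b xs≤b)

  max₀-nonneg : ∀ xs → 0# ≤ max₀ xs
  max₀-nonneg [] = ≤-refl
  max₀-nonneg (x ∷ xs) = ≤-trans (max₀-nonneg xs) (max-≥ʳ x (max₀ xs))

  doubleMax : ∀ {e} → (Fin e → Fin e → Carrier) → Carrier
  doubleMax {e} T = max₀ (map (λ i → max₀ (map (T i) (allFin e))) (allFin e))

  doubleMax-upper : ∀ {e} (T : Fin e → Fin e → Carrier) i j → T i j ≤ doubleMax T
  doubleMax-upper T i j =
    ≤-trans (max₀-upper (∈-map⁺ (T i) (∈-allFin j))) (max₀-upper (∈-map⁺ _ (∈-allFin i)))

  doubleMax-least : ∀ {e} (T : Fin e → Fin e → Carrier) {b} → 0# ≤ b → (∀ i j → T i j ≤ b) → doubleMax T ≤ b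
  doubleMax-least T 0≤b T≤b =
    max₀-least 0≤b (Allₚ.map⁺ (Allₚ.tabulate⁺ (λ i → max₀-least 0≤b (Allₚ.map⁺ (Allₚ.tabulate⁺ (T≤b i))))))

  doubleMax-nonneg : ∀ {e} (T : Fin e → Fin e → Carrier) → 0# ≤ doubleMax T
  doubleMax-nonneg {e} T = max₀-nonneg (map (λ i → max₀ (map (T i) (allFin e))) (allFin e))

  -- Tropical distance. The entries of dtr are defined locally in Defs; we
  -- recover them as the function T with dtr u x ≡ doubleMax T, found by unification.
  dtr-entries : ∀ {e} (u x : Point e) → ∃ λ (T : Fin e → Fin e → Carrier) → dtr u x ≡ doubleMax T
  dtr-entries u x = _ , refl

  dtrEntry : ∀ {e} → Point e → Point e → Fin e → Fin e → Carrier
  dtrEntry u x = proj₁ (dtr-entries u x)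

  diff : ∀ {e} → Point e → Point e → Point e
  diff u x k = u k - x k

  entry-as-offsets : ∀ {e} (u x : Point e) i j → u i - x i - u j + x j ≡ diff u x i - diff u x j
  entry-as-offsets u x i j = trans (+-assoc (u i - x i) (- u j) (x j))
    (cong ((u i - x i) +_) (trans (+-comm (- u j) (x j)) (sym (neg-sub (u j) (x j)))))

  dtrEntry-< : ∀ {e} (u x : Point e) {i j} → i <ᶠ j → dtrEntry u x i j ≡ ∣ diff u x i - diff u x j ∣
  dtrEntry-< u x {i} {j} i<j with i <ᶠ? j
  ... | yes _ = cong ∣_∣ (entry-as-offsets u x i j)
  ... | no i≮j = ⊥-elim (i≮j i<j)

  dtr-nonneg : ∀ {e} (u x : Point e) → 0# ≤ dtr u x
  dtr-nonneg u x = doubleMax-nonneg (dtrEntry u x)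

  dtr-≥-offset : ∀ {e} (u x : Point e) {c a} → c ≢ a → diff u x c - diff u x a ≤ dtr u x
  dtr-≥-offset u x {c} {a} c≢a with Finₚ.<-cmp c a
  ... | tri< c<a _ _ = begin
    diff u x c - diff u x a   ≤⟨ max-≥ˡ _ _ ⟩
    ∣ diff u x c - diff u x a ∣ ≡⟨ sym (dtrEntry-< u x c<a) ⟩
    dtrEntry u x c a          ≤⟨ doubleMax-upper (dtrEntry u x) c a ⟩
    dtr u x                   ∎
  ... | tri≈ _ c≡a _ = ⊥-elim (c≢a c≡a)
  ... | tri> _ _ a<c = begin
    diff u x c - diff u x a       ≡⟨ sym (neg-sub (diff u x a) (diff u x c)) ⟩
    - (diff u x a - diff u x c)   ≤⟨ max-≥ʳ _ _ ⟩
    ∣ diff u x a - diff u x c ∣   ≡⟨ sym (dtrEntry-< u x a<c) ⟩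
    dtrEntry u x a c              ≤⟨ doubleMax-upper (dtrEntry u x) a c ⟩
    dtr u x                       ∎

  dtr-≤-spread : ∀ {e} (u x : Point e) {g} → 0# ≤ g → (∀ k → 0# ≤ diff u x k × diff u x k ≤ g) → dtr u x ≤ g
  dtr-≤-spread u x {g} 0≤g spread = doubleMax-least (dtrEntry u x) 0≤g entry≤g
    where
    entry≤g : ∀ i j → dtrEntry u x i j ≤ g
    entry≤g i j with i <ᶠ? j
    ... | yes _ = subst (_≤ g) (cong ∣_∣ (sym (entry-as-offsets u x i j)))
                      (∣difference∣≤ (proj₁ (spread i)) (proj₂ (spread i)) (proj₁ (spread j)) (proj₂ (spread j)))
    ... | no _ = 0≤g

  dtr-self : ∀ {e} (u : Point e) → dtr u u ≤ 0#
  dtr-self u = dtr-≤-spread u u ≤-refl (λ k → ≤-reflexive (sym (x-x≡0 (u k))) , ≤-reflexive (x-x≡0 (u k)))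

  dist-nonneg : ∀ {e} {u : Point e} {S δ} → DistToSet u S δ → 0# ≤ δ
  dist-nonneg {u = u} (_ , greatest) = greatest 0# (λ x _ → dtr-nonneg u x)

  dist-attained : ∀ {e} {u : Point e} {S δ} → (∀ x → S x → δ ≤ dtr u x) →
                  ∀ x₀ → S x₀ → dtr u x₀ ≤ δ → DistToSet u S δ
  dist-attained lower x₀ x₀∈S near = lower , λ b b-lower → ≤-trans (b-lower x₀ x₀∈S) near

  dist-member : ∀ {e} {u : Point e} {S} → S u → DistToSet u S 0#
  dist-member {u = u} u∈S = dist-attained (λ x _ → dtr-nonneg u x) u u∈S (dtr-self u)

  ∑-cong : ∀ {n} {f g : Fin n → Carrier} → (∀ i → f i ≡ g i) → ∑ f ≡ ∑ g
  ∑-cong {zero} f≗g = refl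
  ∑-cong {suc n} f≗g = cong₂ _+_ (f≗g fzero) (∑-cong (f≗g ∘ fsuc))

  ∑-mono : ∀ {n} {f g : Fin n → Carrier} → (∀ i → f i ≤ g i) → ∑ f ≤ ∑ g
  ∑-mono {zero} f≤g = ≤-refl
  ∑-mono {suc n} f≤g = +-mono (f≤g fzero) (∑-mono (f≤g ∘ fsuc))

  ∑-zero : ∀ n → ∑ {n} (λ _ → 0#) ≡ 0#
  ∑-zero zero = refl
  ∑-zero (suc n) = trans (+-identityˡ _) (∑-zero n)

  ∑-split : ∀ {n} (f : Fin (suc n) → Carrier) i → ∑ f ≡ f i + ∑ (f ∘ punchIn i)
  ∑-split f fzero = refl
  ∑-split {suc n} f (fsuc i) = begin-equality
    f fzero + ∑ (f ∘ fsuc)                              ≡⟨ cong (f fzero +_) (∑-split (f ∘ fsuc) i) ⟩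
    f fzero + (f (fsuc i) + ∑ (f ∘ fsuc ∘ punchIn i))   ≡⟨ x∙yz≈y∙xz (f fzero) (f (fsuc i)) _ ⟩
    f (fsuc i) + (f fzero + ∑ (f ∘ fsuc ∘ punchIn i))   ∎

  ∑-permute : ∀ {n} (f : Fin n → Carrier) (π : Permutation′ n) → ∑ (λ j → f (π ⟨$⟩ʳ j)) ≡ ∑ f
  ∑-permute {zero} f π = refl
  ∑-permute {suc n} f π = begin-equality
    f (π ⟨$⟩ʳ fzero) + ∑ (λ r → f (π ⟨$⟩ʳ fsuc r))
      ≡⟨ cong (f (π ⟨$⟩ʳ fzero) +_) (∑-cong (λ r → cong f (punchIn-permute π fzero r))) ⟩
    f (π ⟨$⟩ʳ fzero) + ∑ (λ r → f (punchIn (π ⟨$⟩ʳ fzero) (remove fzero π ⟨$⟩ʳ r)))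
      ≡⟨ cong (f (π ⟨$⟩ʳ fzero) +_) (∑-permute (f ∘ punchIn (π ⟨$⟩ʳ fzero)) (remove fzero π)) ⟩
    f (π ⟨$⟩ʳ fzero) + ∑ (f ∘ punchIn (π ⟨$⟩ʳ fzero))
      ≡⟨ ∑-split f (π ⟨$⟩ʳ fzero) ⟨
    ∑ f ∎

  ∑-sub : ∀ {n} (f g : Fin n → Carrier) → ∑ (λ i → f i - g i) ≡ ∑ f - ∑ g
  ∑-sub {zero} f g = sym (x-x≡0 0#)
  ∑-sub {suc n} f g = begin-equality
    (f fzero - g fzero) + ∑ (λ i → f (fsuc i) - g (fsuc i)) ≡⟨ cong ((f fzero - g fzero) +_) (∑-sub (f ∘ fsuc) (g ∘ fsuc)) ⟩
    (f fzero - g fzero) + (∑ (f ∘ fsuc) - ∑ (g ∘ fsuc))     ≡⟨ interchange (f fzero) (- g fzero) (∑ (f ∘ fsuc)) (- ∑ (g ∘ fsuc)) ⟩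
    (f fzero + ∑ (f ∘ fsuc)) + (- g fzero - ∑ (g ∘ fsuc))   ≡⟨ cong ((f fzero + ∑ (f ∘ fsuc)) +_) (⁻¹-∙-comm (g fzero) (∑ (g ∘ fsuc))) ⟩
    (f fzero + ∑ (f ∘ fsuc)) - (g fzero + ∑ (g ∘ fsuc))     ∎

  single : ∀ {n} → Fin n → Carrier → Fin n → Carrier
  single i a j with j Fin.≟ i
  ... | yes _ = a
  ... | no _ = 0#

  single-at : ∀ {n} (i : Fin n) a → single i a i ≡ a
  single-at i a with i Fin.≟ i
  ... | yes _ = refl
  ... | no i≢i = ⊥-elim (i≢i refl)

  single-off : ∀ {n} {i j : Fin n} a → j ≢ i → single i a j ≡ 0#
  single-off {i = i} {j} a j≢i with j Fin.≟ i
  ... | yes j≡i = ⊥-elim (j≢i j≡i)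
  ... | no _ = refl

  single-cases : ∀ {n} (i j : Fin n) a → (j ≡ i × single i a j ≡ a) ⊎ (j ≢ i × single i a j ≡ 0#)
  single-cases i j a with j Fin.≟ i
  ... | yes j≡i = inj₁ (j≡i , refl)
  ... | no j≢i = inj₂ (j≢i , refl)

  ∑-single : ∀ {n} (i : Fin (suc n)) a → ∑ (single i a) ≡ a
  ∑-single {n} i a = begin-equality
    ∑ (single i a)                          ≡⟨ ∑-split (single i a) i ⟩
    single i a i + ∑ (single i a ∘ punchIn i) ≡⟨ cong₂ _+_ (single-at i a) (∑-cong (λ r → single-off a (Finₚ.punchInᵢ≢i i r))) ⟩
    a + ∑ {n} (λ _ → 0#)                    ≡⟨ cong (a +_) (∑-zero n) ⟩
    a + 0#                                  ≡⟨ +-identityʳ a ⟩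
    a                                       ∎

  argmax : ∀ {n} (f : Fin (suc n) → Carrier) → ∃ λ c → ∀ k → f k ≤ f c
  argmax {zero} f = fzero , λ { fzero → ≤-refl }
  argmax {suc n} f with argmax (f ∘ fsuc)
  ... | c , c-max with f fzero ≤? f (fsuc c)
  ...   | yes f0≤fc = fsuc c , λ { fzero → f0≤fc ; (fsuc k) → c-max k }
  ...   | no f0≰fc = fzero , λ { fzero → ≤-refl ; (fsuc k) → ≤-trans (c-max k) (≰⇒≥ f0≰fc) }

  rival : ∀ {n} (f : Fin (suc (suc n)) → Carrier) s → ∃ λ g → g ≢ s × (∀ k → k ≢ s → f k ≤ f g)
  rival f s with argmax (f ∘ punchIn s)
  ... | c , c-max = punchIn s c , Finₚ.punchInᵢ≢i s c , λ k k≢s →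
    subst (λ z → f z ≤ f (punchIn s c)) (Finₚ.punchIn-punchOut (k≢s ∘ sym)) (c-max (punchOut (k≢s ∘ sym)))

  minor : ∀ {n} → (Fin (suc n) → Fin (suc n) → Carrier) → Fin (suc n) → Fin (suc n) → Fin n → Fin n → Carrier
  minor B i k r c = B (punchIn i r) (punchIn k c)

  expand : ∀ {n} (B : Fin (suc n) → Fin (suc n) → Carrier) i ρ →
           permSum B ρ ≡ B i (ρ ⟨$⟩ʳ i) + permSum (minor B i (ρ ⟨$⟩ʳ i)) (remove i ρ)
  expand B i ρ = trans (∑-split (λ j → B j (ρ ⟨$⟩ʳ j)) i)
    (cong (B i (ρ ⟨$⟩ʳ i) +_) (∑-cong (λ r → cong (B (punchIn i r)) (punchIn-permute ρ i r))))

  insert-at : ∀ {n} i k (π : Permutation′ n) → insert i k π ⟨$⟩ʳ i ≡ k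
  insert-at i k π with i Fin.≟ i
  ... | yes _ = refl
  ... | no i≢i = ⊥-elim (i≢i refl)

  expand-insert : ∀ {n} (B : Fin (suc n) → Fin (suc n) → Carrier) i k π →
                  permSum B (insert i k π) ≡ B i k + permSum (minor B i k) π
  expand-insert B i k π = trans (∑-split (λ j → B j (insert i k π ⟨$⟩ʳ j)) i)
    (cong₂ _+_ (cong (B i) (insert-at i k π)) (∑-cong (λ r → cong (B (punchIn i r)) (insert-punchIn i k π r))))

  permSum-cong : ∀ {n} {M M′ : Fin n → Fin n → Carrier} → (∀ r c → M r c ≡ M′ r c) → ∀ σ → permSum M σ ≡ permSum M′ σ
  permSum-cong M≗M′ σ = ∑-cong (λ r → M≗M′ r (σ ⟨$⟩ʳ r))

  IsTdet-cong : ∀ {n} {M M′ : Fin n → Fin n → Carrier} {t} → (∀ r c → M r c ≡ M′ r c) → IsTdet M t → IsTdet M′ t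
  IsTdet-cong M≗M′ ((σ , Sσ≡t) , Sσ-max) =
    (σ , trans (sym (permSum-cong M≗M′ σ)) Sσ≡t) , λ τ → subst (_≤ _) (permSum-cong M≗M′ τ) (Sσ-max τ)

  IsTdet-unique : ∀ {n} {M : Fin n → Fin n → Carrier} {t t′} → IsTdet M t → IsTdet M t′ → t ≡ t′
  IsTdet-unique ((σ , Sσ≡t) , Sσ-max) ((σ′ , Sσ′≡t′) , Sσ′-max) =
    ≤-antisym (subst (_≤ _) Sσ≡t (Sσ′-max σ)) (subst (_≤ _) Sσ′≡t′ (Sσ-max σ′))

  module RowExpansion {n} (B : Fin (suc n) → Fin (suc n) → Carrier) (i : Fin (suc n))
                      (p : Fin (suc n) → Carrier) (p-tdet : ∀ k → IsTdet (minor B i k) (p k)) where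

    cofactor : Fin (suc n) → Carrier
    cofactor k = B i k + p k

    permSum≤cofactor : ∀ ρ → permSum B ρ ≤ cofactor (ρ ⟨$⟩ʳ i)
    permSum≤cofactor ρ = begin
      permSum B ρ                                                   ≡⟨ expand B i ρ ⟩
      B i (ρ ⟨$⟩ʳ i) + permSum (minor B i (ρ ⟨$⟩ʳ i)) (remove i ρ)  ≤⟨ +-monoʳ _ (proj₂ (p-tdet (ρ ⟨$⟩ʳ i)) (remove i ρ)) ⟩
      cofactor (ρ ⟨$⟩ʳ i)                                           ∎

    realise : Fin (suc n) → Permutation′ (suc n)
    realise k = insert i k (proj₁ (proj₁ (p-tdet k)))

    realise-at : ∀ k → realise k ⟨$⟩ʳ i ≡ k
    realise-at k = insert-at i k _

    permSum-realise : ∀ k → permSum B (realise k) ≡ cofactor k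
    permSum-realise k = trans (expand-insert B i k _) (cong (B i k +_) (proj₂ (proj₁ (p-tdet k))))

  -- every square matrix has a tropical determinant: by recursion, the minors
  -- along the first row have one, and the best cofactor term is the maximum
  tdet : ∀ n (M : Fin n → Fin n → Carrier) → ∃ (IsTdet M)
  tdet zero M = 0# , (id , refl) , λ _ → ≤-refl
  tdet (suc n) M = cofactor c , (realise c , permSum-realise c) ,
                   λ ρ → ≤-trans (permSum≤cofactor ρ) (c-max (ρ ⟨$⟩ʳ fzero))
    where
    open RowExpansion M fzero (λ k → proj₁ (tdet n (minor M fzero k))) (λ k → proj₂ (tdet n (minor M fzero k)))
    c : Fin (suc n)
    c = proj₁ (argmax cofactor)
    c-max : ∀ k → cofactor k ≤ cofactor c
    c-max = proj₂ (argmax cofactor)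

  permutation-injective : ∀ {n} (π : Permutation′ n) {x y} → π ⟨$⟩ʳ x ≡ π ⟨$⟩ʳ y → x ≡ y
  permutation-injective π {x} {y} πx≡πy = trans (sym (inverseˡ π)) (trans (cong (π ⟨$⟩ˡ_) πx≡πy) (inverseˡ π))

  transpose-at : ∀ {n} (i j : Fin n) → PermComponents.transpose i j i ≡ j
  transpose-at i j with i Fin.≟ i
  ... | yes _ = refl
  ... | no i≢i = ⊥-elim (i≢i refl)

  transpose-rows : ∀ {n} (B : Fin n → Fin n → Carrier) i j → (∀ c → B j c ≡ B i c) →
                   ∀ x c → B (PermComponents.transpose i j x) c ≡ B x c
  transpose-rows B i j same x c with x Fin.≟ i
  ... | yes refl = same c
  ... | no _ with x Fin.≟ j
  ...   | yes refl = sym (same c)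
  ...   | no _ = refl

  -- A matrix with two equal rows is tropically singular: the expansion along
  -- one of them attains its maximum twice, because composing an optimal
  -- permutation with the swap of the two rows gives another optimal one.
  repeated-row-singular : ∀ {n} (B : Fin (suc n) → Fin (suc n) → Carrier) i j → j ≢ i →
    (∀ c → B j c ≡ B i c) → (p : Fin (suc n) → Carrier) → (∀ k → IsTdet (minor B i k) (p k)) →
    AttainedTwice (λ k → B i k + p k)
  repeated-row-singular {n} B i j j≢i same p p-tdet =
    k₁ , ρ′ ⟨$⟩ʳ i , k₁≢ρ′i , ≤-antisym cofactor-k₁≤ (k₁-max (ρ′ ⟨$⟩ʳ i)) , k₁-max
    where
    open RowExpansion B i p p-tdet
    k₁ : Fin (suc n)
    k₁ = proj₁ (argmax cofactor)
    k₁-max : ∀ k → cofactor k ≤ cofactor k₁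
    k₁-max = proj₂ (argmax cofactor)
    ρ ρ′ : Permutation′ (suc n)
    ρ = realise k₁
    ρ′ = transpose i j ∘ₚ ρ
    k₁≢ρ′i : k₁ ≢ ρ′ ⟨$⟩ʳ i
    k₁≢ρ′i k₁≡ρ′i = j≢i (permutation-injective ρ
      (trans (cong (ρ ⟨$⟩ʳ_) (sym (transpose-at i j))) (trans (sym k₁≡ρ′i) (sym (realise-at k₁)))))
    cofactor-k₁≤ : cofactor k₁ ≤ cofactor (ρ′ ⟨$⟩ʳ i)
    cofactor-k₁≤ = begin
      cofactor k₁                                  ≡⟨ permSum-realise k₁ ⟨
      permSum B ρ                                  ≡⟨ ∑-permute (λ x → B x (ρ ⟨$⟩ʳ x)) (transpose i j) ⟨
      ∑ (λ x → B (PermComponents.transpose i j x) (ρ′ ⟨$⟩ʳ x)) ≡⟨ ∑-cong (λ x → transpose-rows B i j same x (ρ′ ⟨$⟩ʳ x)) ⟩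
      permSum B ρ′                                 ≤⟨ permSum≤cofactor ρ′ ⟩
      cofactor (ρ′ ⟨$⟩ʳ i)                         ∎

  AttainedTwice-cong : ∀ {n} {f g : Fin n → Carrier} → (∀ k → f k ≡ g k) → AttainedTwice f → AttainedTwice g
  AttainedTwice-cong f≗g (a , b , a≢b , fa≡fb , fa-max) =
    a , b , a≢b , trans (sym (f≗g a)) (trans fa≡fb (f≗g b)) , λ k → subst₂ _≤_ (f≗g k) (f≗g a) (fa-max k)

  maximiser-avoiding : ∀ {n} {f : Fin n → Carrier} → AttainedTwice f → ∀ s → ∃ λ g → g ≢ s × (∀ k → f k ≤ f g)
  maximiser-avoiding {f = f} (a , b , a≢b , fa≡fb , fa-max) s with a Fin.≟ s
  ... | yes refl = b , a≢b ∘ sym , λ k → subst (f k ≤_) fa≡fb (fa-max k)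
  ... | no a≢s = a , a≢s , fa-max

  offset-via-apex : ∀ {e} (u v x : Point e) k → diff u x k ≡ diff u v k - (- v k + x k)
  offset-via-apex u v x k =
    sym (trans (cong (λ z → (u k - v k) - z) (+-comm (- v k) (x k))) (shift-cancel (u k) (x k) (v k)))

  gap≤dtr : ∀ {e} (u v x : Point e) → Hyperplane v x → ∀ s r →
            (∀ k → k ≢ s → diff u v k ≤ diff u v r) → diff u v s - diff u v r ≤ dtr u x
  gap≤dtr {e} u v x x∈H s r r-max with maximiser-avoiding x∈H s
  ... | g , g≢s , g-max = begin
    w s - w r                   ≤⟨ sub-antitone (w s) (r-max g g≢s) ⟩
    w s - w g                   ≤⟨ x≤x+d (0≤y-x (g-max s)) ⟩
    (w s - w g) + (z g - z s)   ≡⟨ cong ((w s - w g) +_) (neg-sub (z s) (z g)) ⟨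
    (w s - w g) - (z s - z g)   ≡⟨ sub-interchange (w s) (z s) (w g) (z g) ⟨
    (w s - z s) - (w g - z g)   ≡⟨ cong₂ _-_ (offset-via-apex u v x s) (offset-via-apex u v x g) ⟨
    diff u x s - diff u x g     ≤⟨ dtr-≥-offset u x (g≢s ∘ sym) ⟩
    dtr u x                     ∎
    where
    w z : Point e
    w = diff u v
    z k = - v k + x k

  -- Upper bound: if c maximises u - v and a maximises it away from c, then
  -- lowering u at c by the gap gives a point of the hyperplane within that gap.
  near-point : ∀ {e} (u v : Point e) c a → a ≢ c → (∀ k → diff u v k ≤ diff u v c) →
               (∀ k → k ≢ c → diff u v k ≤ diff u v a) →
               ∃ λ x → Hyperplane v x × dtr u x ≤ diff u v c - diff u v a
  near-point {e} u v c a a≢c c-max a-max = x , x∈H , dtr-≤-spread u x 0≤gap spread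
    where
    w : Point e
    w = diff u v
    gap : Carrier
    gap = w c - w a
    0≤gap : 0# ≤ gap
    0≤gap = 0≤y-x (c-max a)
    x : Point e
    x k = u k - single c gap k
    offset : ∀ k → diff u x k ≡ single c gap k
    offset k = x-[x-y]≡y (u k) (single c gap k)
    spread : ∀ k → 0# ≤ diff u x k × diff u x k ≤ gap
    spread k with single-cases c k gap
    ... | inj₁ (_ , at-c) = subst (λ d → 0# ≤ d × d ≤ gap) (sym (trans (offset k) at-c)) (0≤gap , ≤-refl)
    ... | inj₂ (_ , off-c) = subst (λ d → 0# ≤ d × d ≤ gap) (sym (trans (offset k) off-c)) (≤-refl , 0≤gap)
    z : Point e
    z k = - v k + x k
    z≡ : ∀ k → z k ≡ w k - single c gap k
    z≡ k = trans (sym (+-assoc (- v k) (u k) _)) (cong (_- single c gap k) (+-comm (- v k) (u k)))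
    z-at-c : z c ≡ w a
    z-at-c = trans (z≡ c) (trans (cong (λ d → w c - d) (single-at c gap)) (x-[x-y]≡y (w c) (w a)))
    z-off-c : ∀ {k} → k ≢ c → z k ≡ w k
    z-off-c {k} k≢c = trans (z≡ k) (trans (cong (λ d → w k - d) (single-off gap k≢c)) (x-0≡x (w k)))
    x∈H : Hyperplane v x
    x∈H = c , a , a≢c ∘ sym , trans z-at-c (sym (z-off-c a≢c)) , z≤z-c
      where
      z≤z-c : ∀ k → z k ≤ z c
      z≤z-c k with single-cases c k gap
      ... | inj₁ (refl , _) = ≤-refl
      ... | inj₂ (k≢c , _) = subst₂ _≤_ (sym (z-off-c k≢c)) (sym z-at-c) (a-max k k≢c)

  -- Moving along g on the cycles
  -- of σ⁻¹ ∘ g gives a permutation τ ≠ σ whose sum is within ∑ δ of that of σ.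
  exchange : ∀ {n} (B : Fin (suc n) → Fin (suc n) → Carrier) (σ : Permutation′ (suc n))
             (g : Fin (suc n) → Fin (suc n)) → (∀ j → g j ≢ σ ⟨$⟩ʳ j) →
             (δ : Fin (suc n) → Carrier) → (∀ j → 0# ≤ δ j) → (∀ j → B j (σ ⟨$⟩ʳ j) - B j (g j) ≤ δ j) →
             ∃ λ τ → (∃ λ i → τ ⟨$⟩ʳ i ≢ σ ⟨$⟩ʳ i) × permSum B σ - permSum B τ ≤ ∑ δ
  exchange B σ g g≢σ δ 0≤δ loss≤δ with cycle-permutation (λ j → σ ⟨$⟩ˡ g j) fzero
  ... | ρ , fixes-or-follows , y , ρ-follows-at-y = τ , (y , τy≢σy) , (begin
    permSum B σ - permSum B τ                       ≡⟨ ∑-sub (λ j → B j (σ ⟨$⟩ʳ j)) (λ j → B j (τ ⟨$⟩ʳ j)) ⟨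
    ∑ (λ j → B j (σ ⟨$⟩ʳ j) - B j (τ ⟨$⟩ʳ j))       ≤⟨ ∑-mono row-loss ⟩
    ∑ δ                                             ∎)
    where
    -- τ j = σ (ρ j), which is σ j or g j
    τ : Permutation′ _
    τ = ρ ∘ₚ σ
    τ-follows : ∀ {j} → ρ ⟨$⟩ʳ j ≡ σ ⟨$⟩ˡ g j → τ ⟨$⟩ʳ j ≡ g j
    τ-follows ρ-follows = trans (cong (σ ⟨$⟩ʳ_) ρ-follows) (inverseʳ σ)
    τy≢σy : τ ⟨$⟩ʳ y ≢ σ ⟨$⟩ʳ y
    τy≢σy τy≡σy = g≢σ y (trans (sym (τ-follows ρ-follows-at-y)) τy≡σy)
    row-loss : ∀ j → B j (σ ⟨$⟩ʳ j) - B j (τ ⟨$⟩ʳ j) ≤ δ j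
    row-loss j with fixes-or-follows j
    ... | inj₁ ρ-fixes = subst (λ c → B j (σ ⟨$⟩ʳ j) - B j c ≤ δ j) (sym (cong (σ ⟨$⟩ʳ_) ρ-fixes))
                           (subst (_≤ δ j) (sym (x-x≡0 _)) (0≤δ j))
    ... | inj₂ ρ-follows = subst (λ c → B j (σ ⟨$⟩ʳ j) - B j c ≤ δ j) (sym (τ-follows ρ-follows)) (loss≤δ j)

  permSum-shift : ∀ {n} (A : Fin n → Fin n → Carrier) (v : Point n) τ →
                  permSum (λ j → diff (A j) v) τ ≡ permSum A τ - ∑ v
  permSum-shift A v τ = trans (∑-sub (λ j → A j (τ ⟨$⟩ʳ j)) (λ j → v (τ ⟨$⟩ʳ j))) (cong (λ s → permSum A τ - s) (∑-permute v τ))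

  module Volume {n} (A : Fin (suc (suc n)) → Fin (suc (suc n)) → Carrier) (t : Carrier)
                (σ : Permutation′ (suc (suc n))) (m : Carrier)
                (m-bound : ∀ τ → (∃ λ i → τ ⟨$⟩ʳ i ≢ σ ⟨$⟩ʳ i) → permSum A τ ≤ m)
                (t≡ : t ≡ permSum A σ - m) where

    competitor : Point (suc (suc n)) → Fin (suc (suc n)) → Fin (suc (suc n))
    competitor v j = proj₁ (rival (diff (A j) v) (σ ⟨$⟩ʳ j))

    gap : Point (suc (suc n)) → Fin (suc (suc n)) → Carrier
    gap v j = diff (A j) v (σ ⟨$⟩ʳ j) - diff (A j) v (competitor v j)

    gap≤dtr-row : ∀ v j x → Hyperplane v x → gap v j ≤ dtr (A j) x
    gap≤dtr-row v j x x∈H = gap≤dtr (A j) v x x∈H (σ ⟨$⟩ʳ j) (competitor v j)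
                                    (proj₂ (proj₂ (rival (diff (A j) v) (σ ⟨$⟩ʳ j))))

    t≤∑ : ∀ v δ → (∀ j → 0# ≤ δ j) → (∀ j → gap v j ≤ δ j) → t ≤ ∑ δ
    t≤∑ v δ 0≤δ gap≤δ = conclude (exchange B σ (competitor v) competitor≢σ δ 0≤δ gap≤δ)
      where
      B : Fin (suc (suc n)) → Fin (suc (suc n)) → Carrier
      B j = diff (A j) v
      competitor≢σ : ∀ j → competitor v j ≢ σ ⟨$⟩ʳ j
      competitor≢σ j = proj₁ (proj₂ (rival (diff (A j) v) (σ ⟨$⟩ʳ j)))
      conclude : (∃ λ τ → (∃ λ i → τ ⟨$⟩ʳ i ≢ σ ⟨$⟩ʳ i) × permSum B σ - permSum B τ ≤ ∑ δ) → t ≤ ∑ δ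
      conclude (τ , τ≢σ , loss≤∑δ) = begin
        t                                           ≡⟨ t≡ ⟩
        permSum A σ - m                             ≤⟨ sub-antitone (permSum A σ) (m-bound τ τ≢σ) ⟩
        permSum A σ - permSum A τ                   ≡⟨ shift-cancel (permSum A σ) (permSum A τ) (∑ v) ⟨
        (permSum A σ - ∑ v) - (permSum A τ - ∑ v)   ≡⟨ cong₂ _-_ (permSum-shift A v σ) (permSum-shift A v τ) ⟨
        permSum B σ - permSum B τ                   ≤⟨ loss≤∑δ ⟩
        ∑ δ                                         ∎

    t≤∑dist : ∀ v δ → (∀ j → DistToSet (A j) (Hyperplane v) (δ j)) → t ≤ ∑ δ
    t≤∑dist v δ dist = t≤∑ v δ (λ j → dist-nonneg (dist j)) (λ j → proj₂ (dist j) (gap v j) (gap≤dtr-row v j))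

  replaceRow : ∀ {n} → (Fin n → Fin n → Carrier) → Fin n → Fin n → Fin n → Fin n → Carrier
  replaceRow B i j r with r Fin.≟ i
  ... | yes _ = B j
  ... | no _ = B r

  replaceRow-at : ∀ {n} (B : Fin n → Fin n → Carrier) i j c → replaceRow B i j i c ≡ B j c
  replaceRow-at B i j c with i Fin.≟ i
  ... | yes _ = refl
  ... | no i≢i = ⊥-elim (i≢i refl)

  replaceRow-off : ∀ {n} (B : Fin n → Fin n → Carrier) {i} j {r} → r ≢ i → ∀ c → replaceRow B i j r c ≡ B r c
  replaceRow-off B {i} j {r} r≢i c with r Fin.≟ i
  ... | yes r≡i = ⊥-elim (r≢i r≡i)
  ... | no _ = refl

  -- The optimal hyperplane: its apex is minus the vector of tropical minors
  -- of A along row i, where some second-best permutation τ₂ differs from σ at i.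
  module OptimalHyperplane {n} (A : Fin (suc (suc n)) → Fin (suc (suc n)) → Carrier) (t : Carrier)
                (σ : Permutation′ (suc (suc n))) (σ-opt : ∀ τ → permSum A τ ≤ permSum A σ) (m : Carrier)
                (m-bound : ∀ τ → (∃ λ i → τ ⟨$⟩ʳ i ≢ σ ⟨$⟩ʳ i) → permSum A τ ≤ m)
                (t≡ : t ≡ permSum A σ - m)
                (τ₂ : Permutation′ (suc (suc n))) (i : Fin (suc (suc n))) (τ₂i≢σi : τ₂ ⟨$⟩ʳ i ≢ σ ⟨$⟩ʳ i)
                (Sτ₂≡m : permSum A τ₂ ≡ m) where

    open Volume A t σ m m-bound t≡ using (t≤∑; gap; gap≤dtr-row)

    p : Fin (suc (suc n)) → Carrier
    p k = proj₁ (tdet (suc n) (minor A i k))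

    p-tdet : ∀ k → IsTdet (minor A i k) (p k)
    p-tdet k = proj₂ (tdet (suc n) (minor A i k))

    open RowExpansion A i p p-tdet using (cofactor; permSum≤cofactor; realise; permSum-realise)

    apex : Point (suc (suc n))
    apex k = - p k

    H : Point (suc (suc n)) → Set
    H = Hyperplane apex

    offset-is-cofactor : ∀ j k → diff (A j) apex k ≡ A j k + p k
    offset-is-cofactor j k = cong (A j k +_) (⁻¹-involutive (p k))

    hyperplane-form : ∀ (x : Point (suc (suc n))) k → - apex k + x k ≡ p k + x k
    hyperplane-form x k = cong (_+ x k) (⁻¹-involutive (p k))

    -- every other point lies on H: replacing row i of A by row j gives a
    -- matrix with a repeated row, whose row-i expansion is the function defining H at A j
    other-rows-on-H : ∀ j → j ≢ i → H (A j)
    other-rows-on-H j j≢i = AttainedTwice-cong rearrange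
      (repeated-row-singular B i j j≢i (λ c → trans (replaceRow-off A j j≢i c) (sym (replaceRow-at A i j c)))
                             p (λ k → IsTdet-cong (λ r c → sym (replaceRow-off A j (Finₚ.punchInᵢ≢i i r) (punchIn k c))) (p-tdet k)))
      where
      B : Fin (suc (suc n)) → Fin (suc (suc n)) → Carrier
      B = replaceRow A i j
      rearrange : ∀ k → B i k + p k ≡ - apex k + A j k
      rearrange k = trans (cong (_+ p k) (replaceRow-at A i j k)) (trans (+-comm (A j k) (p k)) (sym (hyperplane-form (A j) k)))

    t≤dtr : ∀ x → H x → t ≤ dtr (A i) x
    t≤dtr x x∈H = subst (t ≤_) (∑-single i (dtr (A i) x)) (t≤∑ apex δ 0≤δ gap≤δ)
      where
      δ : Fin (suc (suc n)) → Carrier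
      δ = single i (dtr (A i) x)
      0≤δ : ∀ j → 0# ≤ δ j
      0≤δ j with single-cases i j (dtr (A i) x)
      ... | inj₁ (_ , at-i) = subst (0# ≤_) (sym at-i) (dtr-nonneg (A i) x)
      ... | inj₂ (_ , off-i) = ≤-reflexive (sym off-i)
      gap≤δ : ∀ j → gap apex j ≤ δ j
      gap≤δ j with single-cases i j (dtr (A i) x)
      ... | inj₁ (refl , at-i) = subst (gap apex i ≤_) (sym at-i) (gap≤dtr-row apex i x x∈H)
      ... | inj₂ (j≢i , off-i) = subst (gap apex j ≤_) (sym off-i)
                                   (≤-trans (gap≤dtr-row apex j (A j) (other-rows-on-H j j≢i)) (dtr-self (A j)))

    -- … and this distance is attained, by lowering A i at its top coordinate
    c a : Fin (suc (suc n))
    c = proj₁ (argmax (diff (A i) apex))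
    a = proj₁ (rival (diff (A i) apex) c)
    c-max : ∀ k → diff (A i) apex k ≤ diff (A i) apex c
    c-max = proj₂ (argmax (diff (A i) apex))
    a≢c : a ≢ c
    a≢c = proj₁ (proj₂ (rival (diff (A i) apex) c))
    a-max : ∀ k → k ≢ c → diff (A i) apex k ≤ diff (A i) apex a
    a-max = proj₂ (proj₂ (rival (diff (A i) apex) c))

    -- m is below the cofactors of both σ i and τ₂ i, one of which differs from c
    m≤cofactor-a : m ≤ cofactor a
    m≤cofactor-a = via (σ ⟨$⟩ʳ i Fin.≟ c)
      where
      m≤cofactor-σi : m ≤ cofactor (σ ⟨$⟩ʳ i)
      m≤cofactor-σi = ≤-trans (≤-reflexive (sym Sτ₂≡m)) (≤-trans (σ-opt τ₂) (permSum≤cofactor σ))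
      m≤cofactor-τ₂i : m ≤ cofactor (τ₂ ⟨$⟩ʳ i)
      m≤cofactor-τ₂i = ≤-trans (≤-reflexive (sym Sτ₂≡m)) (permSum≤cofactor τ₂)
      cofactor≤a : ∀ {k} → k ≢ c → cofactor k ≤ cofactor a
      cofactor≤a {k} k≢c = subst₂ _≤_ (offset-is-cofactor i k) (offset-is-cofactor i a) (a-max k k≢c)
      via : Dec (σ ⟨$⟩ʳ i ≡ c) → m ≤ cofactor a
      via (yes σi≡c) = ≤-trans m≤cofactor-τ₂i (cofactor≤a (λ τ₂i≡c → τ₂i≢σi (trans τ₂i≡c (sym σi≡c))))
      via (no σi≢c) = ≤-trans m≤cofactor-σi (cofactor≤a σi≢c)

    top-gap≤t : diff (A i) apex c - diff (A i) apex a ≤ t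
    top-gap≤t = begin
      diff (A i) apex c - diff (A i) apex a   ≡⟨ cong₂ _-_ (offset-is-cofactor i c) (offset-is-cofactor i a) ⟩
      cofactor c - cofactor a                 ≤⟨ +-mono-≤ (- cofactor a) (subst (_≤ permSum A σ) (permSum-realise c) (σ-opt (realise c))) ⟩
      permSum A σ - cofactor a                ≤⟨ sub-antitone (permSum A σ) m≤cofactor-a ⟩
      permSum A σ - m                         ≡⟨ t≡ ⟨
      t                                       ∎

    dist-row-i : DistToSet (A i) H t
    dist-row-i = attained (near-point (A i) apex c a a≢c c-max a-max)
      where
      attained : (∃ λ x → H x × dtr (A i) x ≤ diff (A i) apex c - diff (A i) apex a) → DistToSet (A i) H t
      attained (x₀ , x₀∈H , near) = dist-attained t≤dtr x₀ x₀∈H (≤-trans near top-gap≤t)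

    dist-rows : ∀ j → DistToSet (A j) H (single i t j)
    dist-rows j with single-cases i j t
    ... | inj₁ (refl , at-i) = subst (DistToSet (A i) H) (sym at-i) dist-row-i
    ... | inj₂ (j≢i , off-i) = subst (DistToSet (A j) H) (sym off-i) (dist-member (other-rows-on-H j j≢i))

    -- H is the Stiefel tropical linear space of the remaining rows M: the only
    -- (n+2)-subset of the n+2 columns is the whole set, with Plücker vector p
    M : Fin (suc n) → Fin (suc (suc n)) → Carrier
    M r c = A (punchIn i r) c

    H⇒Stiefel : ∀ x → H x → Stiefel M x
    H⇒Stiefel x x∈H (f , f-increasing) q q-tdet = AttainedTwice-cong form x∈H
      where
      f-id : ∀ k → f k ≡ k
      f-id = increasing⇒id f f-increasing
      q≡p : ∀ k → q k ≡ p k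
      q≡p k = IsTdet-unique {M = minor A i k} (IsTdet-cong (λ r c → cong (M r) (f-id (punchIn k c))) (q-tdet k)) (p-tdet k)
      form : ∀ k → - apex k + x k ≡ q k + x (f k)
      form k = trans (hyperplane-form x k) (cong₂ _+_ (sym (q≡p k)) (cong x (sym (f-id k))))

    Stiefel⇒H : ∀ x → Stiefel M x → H x
    Stiefel⇒H x x∈L = AttainedTwice-cong (λ k → sym (hyperplane-form x k))
                                         (x∈L ((λ k → k) , λ _ _ a<b → a<b) p p-tdet)

theorem3p3 : (ℝ : RealField) → let open Tropical ℝ in
    (d : ℕ) → 1 ≤ℕ d →
    (D : Fin (suc d) → Point (suc d)) →
    let A : Fin (suc d) → Fin (suc d) → Carrier
        A i j = D i j
    in (t : Carrier) → IsTvol A t →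
      ((v : Point (suc d)) → (δ : Fin (suc d) → Carrier) →
        (∀ j → DistToSet (D j) (Hyperplane v) (δ j)) → t ≤ ∑ δ)
      × (∃ λ (v : Point (suc d)) → ∃ λ (i : Fin (suc d)) →
          (∀ x → (Hyperplane v x → Stiefel (λ r c → A (punchIn i r) c) x)
                 × (Stiefel (λ r c → A (punchIn i r) c) x → Hyperplane v x))
          × ∃ λ (δ : Fin (suc d) → Carrier) →
              (∀ j → DistToSet (D j) (Hyperplane v) (δ j)) × ∑ δ ≡ t)
theorem3p3 ℝ zero ()
theorem3p3 ℝ (suc n) _ D t (σ , σ-opt , m , (((τ₂ , i , τ₂i≢σi) , Sτ₂≡m) , m-max) , t≡) =
  t≤∑dist , apex , i , (λ x → H⇒Stiefel x , Stiefel⇒H x) , single i t , dist-rows , ∑-single i t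
  where
  open Tropical ℝ
  open Geometry ℝ
  A : Fin (suc (suc n)) → Fin (suc (suc n)) → Carrier
  A r c = D r c
  m-bound : ∀ τ → (∃ λ k → τ ⟨$⟩ʳ k ≢ σ ⟨$⟩ʳ k) → permSum A τ ≤ m
  m-bound τ τ≢σ = m-max (τ , τ≢σ)
  open Volume A t σ m m-bound t≡ using (t≤∑dist)
  open OptimalHyperplane A t σ σ-opt m m-bound t≡ τ₂ i τ₂i≢σi Sτ₂≡m
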